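{- For all $\sigma,\tau,\pi\in\omega^{<\omega}$: if $\sigma\subseteq\tau\subseteq\pi$ and $J(\sigma)\subseteq J(\pi)$, then $J(\sigma)\subseteq J(\tau)$.
   Context: $\subseteq$ is the prefix relation on finite strings, $\langle\rangle$ the empty string. Fix an effective enumeration $\varphi_0,\varphi_1,\dots$ of Turing functionals; for a finite string $\sigma$, $\varphi_e^\sigma(i)\downarrow$ means the computation with oracle $\sigma$ converges within $|\sigma|$ steps. Finite strings are identified with natural numbers via a fixed computable coding. The jump approximation function $J:\omega^{<\omega}\to\omega^{<\omega}$: given $\sigma$, let $t_{ -1}=1$ and for $i\ge0$ let $t_i=t_{i-1}+1$ if $\varphi_i^\sigma(i)\uparrow$, and $t_i=\max\{t_{i-1}+1,\ \mu t\,(\varphi_i^{\sigma\restriction t}(i)\downarrow)\}$ if $\varphi_i^\sigma(i)\downarrow$. Then $J(\sigma)=\langle\sigma\restriction t_0,\sigma\restriction t_1,\dots,\sigma\restriction t_k\rangle$ (entries are codes of these strings), where $k$ is least with $t_{k+1}>|\sigma|$; $J(\sigma)=\langle\rangle$ if $t_0>|\sigma|$. -}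

module Defs where

open import Data.Nat using (ℕ; zero; suc; _≤?_; _⊔_)
open import Data.Bool using (Bool; true; false; if_then_else_)
open import Data.List using (List; []; _∷_; take; length; map)
open import Data.List.Relation.Binary.Prefix.Heterogeneous using (Prefix)
open import Relation.Binary.PropositionalEquality using (_≡_)
open import Relation.Nullary.Decidable using (does)

Str : Set
Str = List ℕ

_⊑_ : ∀ {A : Set} → List A → List A → Set
σ ⊑ τ = Prefix _≡_ σ τ

-- An enumeration of Turing functionals, given by its step-bounded
-- convergence predicate:  Conv e σ i ≡ true  iff  φ_e^σ(i)↓, i.e. the
-- computation of φ_e with oracle σ on input i converges within |σ| steps.
Conv : Set
Conv = ℕ → Str → ℕ → Bool

-- The standard property of step-bounded oracle computations: convergence
-- is preserved when the oracle (and hence the step bound) is extended.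
Monotone : Conv → Set
Monotone φ = ∀ e σ τ i → σ ⊑ τ → φ e σ i ≡ true → φ e τ i ≡ true

least-from : (ℕ → Bool) → ℕ → ℕ → ℕ → ℕ
least-from p dflt k zero = dflt
least-from p dflt k (suc fuel) = if p k then k else least-from p dflt (suc k) fuel

-- μt (φ_i^{σ↾t}(i)↓), where σ↾t = take t σ.  Only used when φ_i^σ(i)↓,
-- in which case t = |σ| is a witness, so searching t ≤ |σ| suffices.
mu : Conv → Str → ℕ → ℕ
mu φ σ i = least-from (λ t → φ i (take t σ) i) (length σ) 0 (suc (length σ))

next-t : Conv → Str → ℕ → ℕ → ℕ
next-t φ σ i prev =
  if φ i σ i then (suc prev ⊔ mu φ σ i) else suc prev

-- The list t_i, t_{i+1}, ..., t_k (all ≤ |σ|), stopping at the first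
-- t_{k+1} > |σ|.  Since t_i ≥ i + 2, fuel |σ| + 1 is ample.
ts-from : Conv → Str → ℕ → ℕ → ℕ → List ℕ
ts-from φ σ zero i prev = []
ts-from φ σ (suc fuel) i prev with next-t φ σ i prev
... | t = if does (t ≤? length σ) then t ∷ ts-from φ σ fuel (suc i) t else []

-- t_0, ..., t_k  (starting from t_{-1} = 1).
ts : Conv → Str → List ℕ
ts φ σ = ts-from φ σ (suc (length σ)) 0 1

J : Conv → Str → List Str
J φ σ = map (λ t → take t σ) (ts φ σ)

-- Each t_i is a function of t_{i-1} that is stable under extending the oracle once
-- φ_i^σ(i) converges: the search for μt only inspects σ↾t for t ≤ |σ|, which all
-- extensions share.  So if J(σ) ⊆ J(π), then t_i(σ) = t_i(π) for every listed i, and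
-- t_i(τ) agrees with them: if φ_i^σ(i)↓ by stability from σ to τ, if φ_i^σ(i)↑ and
-- φ_i^τ(i)↑ because both equal t_{i-1} + 1, and if φ_i^σ(i)↑ but φ_i^τ(i)↓ by
-- stability from τ to π.
module Submission where

open import Defs
open import Data.Bool using (Bool; true; false)
open import Data.List using (List; []; _∷_; take; length; map)
open import Data.List.Properties using (length-take; take-all)
open import Data.List.Relation.Binary.Prefix.Heterogeneous using ([]; _∷_)
open import Data.List.Relation.Binary.Prefix.Heterogeneous.Properties using (length-mono)
open import Data.List.Relation.Unary.All using (All; []; _∷_)
open import Data.Nat using (ℕ; zero; suc; _+_; _⊔_; _≤_; _<_; _≤?_; z≤n; s≤s)
open import Data.Nat.Properties
  using (≤-refl; ≤-trans; <⇒≱; ≤∧≢⇒<; n<1+n; +-suc; +-identityʳ; m≤n⇒m⊓n≡m)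
open import Data.Product using (Σ; _×_; _,_)
open import Data.Sum using (_⊎_; inj₁; inj₂)
open import Relation.Binary.PropositionalEquality
  using (_≡_; _≢_; refl; sym; trans; cong; cong₂; subst)
open import Relation.Nullary using (¬_; yes; no; contradiction)
open import Relation.Nullary.Decidable using (dec-true; dec-false)

take-⊑ : ∀ {σ τ : Str} t → σ ⊑ τ → t ≤ length σ → take t σ ≡ take t τ
take-⊑ zero    _         _         = refl
take-⊑ (suc t) (x≡y ∷ p) (s≤s t≤) = cong₂ _∷_ x≡y (take-⊑ t p t≤)

length-take≤ : ∀ t (σ : Str) → t ≤ length σ → length (take t σ) ≡ t
length-take≤ t σ t≤ = trans (length-take t σ) (m≤n⇒m⊓n≡m t≤)

take-injective : ∀ {s t} (σ τ : Str) → s ≤ length σ → t ≤ length τ →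
  take s σ ≡ take t τ → s ≡ t
take-injective {s} {t} σ τ s≤ t≤ e =
  trans (sym (length-take≤ s σ s≤)) (trans (cong length e) (length-take≤ t τ t≤))

map-take-⊑⁻ : ∀ {σ π : Str} {ss ts} → All (_≤ length σ) ss → All (_≤ length π) ts →
  map (λ t → take t σ) ss ⊑ map (λ t → take t π) ts → ss ⊑ ts
map-take-⊑⁻         []          _           _       = []
map-take-⊑⁻ {σ} {π} (s≤ ∷ ss≤) (t≤ ∷ ts≤) (e ∷ p) =
  take-injective σ π s≤ t≤ e ∷ map-take-⊑⁻ ss≤ ts≤ p

map-take-⊑⁺ : ∀ {σ τ : Str} {ss ts} → σ ⊑ τ → All (_≤ length σ) ss → ss ⊑ ts →
  map (λ t → take t σ) ss ⊑ map (λ t → take t τ) ts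
map-take-⊑⁺ _   []         []              = []
map-take-⊑⁺ σ⊑τ (s≤ ∷ ss≤) (refl ∷ ss⊑ts) = take-⊑ _ σ⊑τ s≤ ∷ map-take-⊑⁺ σ⊑τ ss≤ ss⊑ts

least-from-agree : ∀ (p q : ℕ → Bool) {d d'} k f f' {t} → k ≤ t → t < k + f → t < k + f' →
  (∀ s → s ≤ t → p s ≡ q s) → p t ≡ true → least-from p d k f ≡ least-from q d' k f'
least-from-agree p q k zero f' k≤t t<k+0 _ _ _ =
  contradiction k≤t (<⇒≱ (subst (_ <_) (+-identityʳ k) t<k+0))
least-from-agree p q k (suc f) zero k≤t _ t<k+0 _ _ =
  contradiction k≤t (<⇒≱ (subst (_ <_) (+-identityʳ k) t<k+0))
least-from-agree p q k (suc f) (suc f') {t} k≤t t<k+f t<k+f' agree pt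
  rewrite agree k k≤t with q k in qk
... | true  = refl
... | false = least-from-agree p q (suc k) f f' (≤∧≢⇒< k≤t k≢t)
                (subst (t <_) (+-suc k f) t<k+f) (subst (t <_) (+-suc k f') t<k+f') agree pt
  where
  k≢t : k ≢ t
  k≢t refl with trans (sym pt) (trans (agree k k≤t) qk)
  ... | ()

module _ (φ : Conv) where

  next-t-converged : ∀ {σ i} prev → φ i σ i ≡ true → next-t φ σ i prev ≡ suc prev ⊔ mu φ σ i
  next-t-converged prev e rewrite e = refl

  next-t-diverged : ∀ {σ i} prev → φ i σ i ≡ false → next-t φ σ i prev ≡ suc prev
  next-t-diverged prev e rewrite e = refl

  ts-from-cons : ∀ σ f i prev → next-t φ σ i prev ≤ length σ →
    ts-from φ σ (suc f) i prev ≡ next-t φ σ i prev ∷ ts-from φ σ f (suc i) (next-t φ σ i prev)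
  ts-from-cons σ f i prev t≤ rewrite dec-true (next-t φ σ i prev ≤? length σ) t≤ = refl

  ts-from-nil : ∀ σ f i prev → ¬ next-t φ σ i prev ≤ length σ → ts-from φ σ (suc f) i prev ≡ []
  ts-from-nil σ f i prev t≰ rewrite dec-false (next-t φ σ i prev ≤? length σ) t≰ = refl

  ts-from-step : ∀ σ f i prev →
    (next-t φ σ i prev ≤ length σ ×
      ts-from φ σ (suc f) i prev ≡ next-t φ σ i prev ∷ ts-from φ σ f (suc i) (next-t φ σ i prev))
    ⊎ (¬ next-t φ σ i prev ≤ length σ × ts-from φ σ (suc f) i prev ≡ [])
  ts-from-step σ f i prev with next-t φ σ i prev ≤? length σ
  ... | yes t≤ = inj₁ (t≤ , ts-from-cons σ f i prev t≤)
  ... | no  t≰ = inj₂ (t≰ , ts-from-nil σ f i prev t≰)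

  ts-from-bounded : ∀ σ f i prev → All (_≤ length σ) (ts-from φ σ f i prev)
  ts-from-bounded σ zero    i prev = []
  ts-from-bounded σ (suc f) i prev with ts-from φ σ (suc f) i prev | ts-from-step σ f i prev
  ... | _ | inj₁ (t≤ , refl) = t≤ ∷ ts-from-bounded σ f (suc i) (next-t φ σ i prev)
  ... | _ | inj₂ (_  , refl) = []

  ∷-⊑-ts-from : ∀ {t ts} π h i prev → (t ∷ ts) ⊑ ts-from φ π h i prev →
    next-t φ π i prev ≡ t × Σ ℕ λ h' → ts ⊑ ts-from φ π h' (suc i) t
  ∷-⊑-ts-from π (suc h) i prev t∷ts⊑
    with ts-from φ π (suc h) i prev | ts-from-step π h i prev | t∷ts⊑
  ... | _ | inj₁ (_ , refl) | refl ∷ ts⊑ = refl , h , ts⊑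
  ... | _ | inj₂ (_ , refl) | ()

  module _ (mono : Monotone φ) where

    mu-⊑ : ∀ {σ τ : Str} i → σ ⊑ τ → φ i σ i ≡ true → mu φ τ i ≡ mu φ σ i
    mu-⊑ {σ} {τ} i σ⊑τ conv =
      least-from-agree (λ t → φ i (take t τ) i) (λ t → φ i (take t σ) i) 0
        (suc (length τ)) (suc (length σ)) z≤n (s≤s (length-mono σ⊑τ)) (n<1+n _)
        (λ s s≤ → sym (cong (λ ρ → φ i ρ i) (take-⊑ s σ⊑τ s≤)))
        (trans (cong (λ ρ → φ i ρ i) (sym (take-⊑ (length σ) σ⊑τ ≤-refl)))
          (trans (cong (λ ρ → φ i ρ i) (take-all (length σ) σ ≤-refl)) conv))

    next-t-⊑ : ∀ {σ τ : Str} i prev → σ ⊑ τ → φ i σ i ≡ true →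
      next-t φ τ i prev ≡ next-t φ σ i prev
    next-t-⊑ i prev σ⊑τ conv =
      trans (next-t-converged prev (mono i _ _ i σ⊑τ conv))
        (trans (cong (suc prev ⊔_) (mu-⊑ i σ⊑τ conv)) (sym (next-t-converged prev conv)))

    next-t-between : ∀ {σ τ π : Str} i prev → σ ⊑ τ → τ ⊑ π →
      next-t φ π i prev ≡ next-t φ σ i prev → next-t φ τ i prev ≡ next-t φ σ i prev
    next-t-between {σ} {τ} i prev σ⊑τ τ⊑π eq = by-cases (φ i σ i) (φ i τ i) refl refl
      where
      by-cases : ∀ b c → φ i σ i ≡ b → φ i τ i ≡ c → next-t φ τ i prev ≡ next-t φ σ i prev
      by-cases true  _     σ-conv _      = next-t-⊑ i prev σ⊑τ σ-conv
      by-cases false true  _      τ-conv = trans (sym (next-t-⊑ i prev τ⊑π τ-conv)) eq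
      by-cases false false σ-div  τ-div  =
        trans (next-t-diverged prev τ-div) (sym (next-t-diverged prev σ-div))

    ts-from-between : ∀ {σ τ π : Str} {f g h} i prev → σ ⊑ τ → τ ⊑ π → f ≤ g →
      ts-from φ σ f i prev ⊑ ts-from φ π h i prev → ts-from φ σ f i prev ⊑ ts-from φ τ g i prev
    ts-from-between {f = zero} i prev _ _ _ _ = []
    ts-from-between {σ} {τ} {π} {suc f} {suc g} {h} i prev σ⊑τ τ⊑π (s≤s f≤g) σ⊑π
      with ts-from φ σ (suc f) i prev | ts-from-step σ f i prev
    ... | _ | inj₂ (_ , refl) = []
    ... | _ | inj₁ (t≤ , refl) with ∷-⊑-ts-from π h i prev σ⊑π
    ... | tπ≡tσ , h' , ts⊑ =
      subst (_ ⊑_) (sym τ-list) (refl ∷ ts-from-between {h = h'} (suc i) tσ σ⊑τ τ⊑π f≤g ts⊑)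
      where
      tσ = next-t φ σ i prev
      tτ≡tσ = next-t-between i prev σ⊑τ τ⊑π tπ≡tσ
      τ-list : ts-from φ τ (suc g) i prev ≡ tσ ∷ ts-from φ τ g (suc i) tσ
      τ-list = trans (ts-from-cons τ g i prev tτ≤) (cong (λ t → t ∷ ts-from φ τ g (suc i) t) tτ≡tσ)
        where tτ≤ = subst (_≤ length τ) (sym tτ≡tσ) (≤-trans t≤ (length-mono σ⊑τ))

lemma6p4 : (φ : Conv) → Monotone φ →
    (σ τ π : Str) → σ ⊑ τ → τ ⊑ π → J φ σ ⊑ J φ π → J φ σ ⊑ J φ τ
lemma6p4 φ mono σ τ π σ⊑τ τ⊑π Jσ⊑Jπ =
  map-take-⊑⁺ σ⊑τ (ts-bounded σ)
    (ts-from-between φ mono {h = suc (length π)} 0 1 σ⊑τ τ⊑π (s≤s (length-mono σ⊑τ))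
      (map-take-⊑⁻ (ts-bounded σ) (ts-bounded π) Jσ⊑Jπ))
  where
  ts-bounded : ∀ ρ → All (_≤ length ρ) (ts φ ρ)
  ts-bounded ρ = ts-from-bounded φ ρ (suc (length ρ)) 0 1
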